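{- Let $\mathcal M=(D,M)$ be a $\mathrm{3LQST_0}$-interpretation, $D^*\subseteq D$, $d^*\in D^*$, $\mathcal V_0'\subseteq\mathcal V_0$, $\mathcal V_1'\subseteq\mathcal V_1$, $l>0$, and $\mathcal M^*=(D^*,M^*)=\mathrm{Rel}(\mathcal M,D^*,d^*,\mathcal V_0',\mathcal V_1',l)$. Let $\psi$ be a propositional combination of atoms of the forms $x=y$, $x\in X$, $\{x_1,\dots,x_k\}=X$, $\{x_1,\dots,x_k\}\in A$, $X=Y$, $X\in A$ such that: $Mx\in D^*$ for every level-0 variable $x$ in $\psi$; $k\le l$ for every enumeration in $\psi$; $X\in\mathcal V_1'$ for every set variable $X$ occurring in an atom of the form $X=Y$ or $X\in A$ in $\psi$; for every $X\in\mathcal V_1'$, $M^*X=MX$ if $|MX|\le l$ and $|M^*X|>l$ otherwise; $(MX\mathbin{\Delta}MY)\cap D^*\ne\emptyset$ for all $X,Y\in\mathcal V_1'$ with $MX\ne MY$; and $M^*X=MX$ for every $X\in\mathcal V_1\setminus\mathcal V_1'$ occurring in $\psi$. Then $\mathcal M\models\psi$ iff $\mathcal M^*\models\psi$.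
   Context: Variables: $\mathcal V_0$ (individual), $\mathcal V_1$ (set), $\mathcal V_2$ (collection). A $\mathrm{3LQST_0}$-interpretation is $(D,M)$ with $D\ne\emptyset$, $Mx\in D$, $MX\subseteq D$, $MA\subseteq\mathrm{pow}(D)$; $\{x_1,\dots,x_k\}$ denotes $\{Mx_1,\dots,Mx_k\}$; $=,\in$ standard; connectives classical. $\Delta$ is symmetric difference. Relativized interpretation: $\mathrm{Rel}(\mathcal M,D^*,d^*,\mathcal V_0',\mathcal V_1',l)=(D^*,M^*)$ with $M^*x=Mx$ if $Mx\in D^*$, else $d^*$; $M^*X=MX\cap D^*$; $M^*A=\big((MA\cap\mathrm{pow}(D^*))\setminus(\{M^*X:X\in\mathcal V_1'\}\cup\mathrm{pow}_{\le l}(S))\big)\cup\{M^*X:X\in\mathcal V_1',MX\in MA\}\cup(\mathrm{pow}_{\le l}(S)\cap MA)$, $S=\{M^*x:x\in\mathcal V_0'\}$, $\mathrm{pow}_{\le l}(S)$ the subsets of $S$ with at most $l$ elements. -}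

module Defs where

open import Level using (_⊔_; suc; 0ℓ)

open import Data.Nat using (ℕ; _≤_)
open import Data.Bool using (Bool; true; false; T)
open import Data.Bool.Properties using (T?)
open import Data.Unit using (⊤; tt)
open import Data.Empty using (⊥)
open import Data.Product using (Σ; _×_; _,_; proj₁; proj₂)
open import Data.Sum using (_⊎_; inj₁; inj₂)
open import Data.List using (List; []; _∷_; _++_; length)
open import Data.List.NonEmpty using (List⁺; toList)
open import Data.List.Relation.Unary.Any using (Any)
open import Data.List.Membership.Propositional using (_∈_)
open import Relation.Nullary using (¬_; Dec; yes; no)
open import Relation.Binary.PropositionalEquality using (_≡_)

Var₀ Var₁ Var₂ : Set
Var₀ = ℕ
Var₁ = ℕ
Var₂ = ℕ

Subset : ∀ {a} → Set a → Set (a ⊔ suc 0ℓ)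
Subset E = E → Set

_⊆_ : ∀ {a} {E : Set a} → Subset E → Subset E → Set a
s ⊆ t = ∀ e → s e → t e

_≐_ : ∀ {a} {E : Set a} → Subset E → Subset E → Set a
s ≐ t = (s ⊆ t) × (t ⊆ s)

≐-sym : ∀ {a} {E : Set a} {s t : Subset E} → s ≐ t → t ≐ s
≐-sym (a , b) = b , a

≐-trans : ∀ {a} {E : Set a} {s t u : Subset E} → s ≐ t → t ≐ u → s ≐ u
≐-trans (a , b) (c , d) = (λ e x → c e (a e x)) , (λ e x → b e (d e x))

SymDiff : {E : Set} → Subset E → Subset E → Subset E
SymDiff s t e = (s e × ¬ t e) ⊎ (t e × ¬ s e)

card≤ : {E : Set} → ℕ → Subset E → Set
card≤ {E} l s = Σ (List E) λ xs → (length xs ≤ l) × (∀ e → s e → e ∈ xs)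

card> : {E : Set} → ℕ → Subset E → Set
card> l s = ¬ card≤ l s

-- 3LQST0-interpretations (D, M)
-- D ≠ ∅ is automatic since M₀ maps the (nonempty) set of individual
-- variables into D.  Collections are sets of subsets of D, hence their
-- membership respects extensional equality of subsets.

record Interp : Set₁ where
  field
    D   : Set
    M₀  : Var₀ → D
    M₁  : Var₁ → Subset D
    M₂  : Var₂ → Subset (Subset D)
    M₂-ext : ∀ A {s t} → s ≐ t → M₂ A s → M₂ A t

data Atom : Set where
  eq₀    : Var₀ → Var₀ → Atom
  mem₀   : Var₀ → Var₁ → Atom
  enumEq  : List⁺ Var₀ → Var₁ → Atom
  enumMem : List⁺ Var₀ → Var₂ → Atom
  eq₁    : Var₁ → Var₁ → Atom
  mem₁   : Var₁ → Var₂ → Atom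

data Form : Set where
  atom  : Atom → Form
  ¬'_   : Form → Form
  _∧'_  : Form → Form → Form
  _∨'_  : Form → Form → Form
  _⇒'_  : Form → Form → Form
  _⇔'_  : Form → Form → Form

module _ (I : Interp) where
  open Interp I

  enumSet : List⁺ Var₀ → Subset D
  enumSet xs d = Any (λ x → d ≡ M₀ x) (toList xs)

  ⟦_⟧ᵃ : Atom → Set
  ⟦ eq₀ x y ⟧ᵃ      = M₀ x ≡ M₀ y
  ⟦ mem₀ x X ⟧ᵃ     = M₁ X (M₀ x)
  ⟦ enumEq xs X ⟧ᵃ  = enumSet xs ≐ M₁ X
  ⟦ enumMem xs A ⟧ᵃ = M₂ A (enumSet xs)
  ⟦ eq₁ X Y ⟧ᵃ      = M₁ X ≐ M₁ Y
  ⟦ mem₁ X A ⟧ᵃ     = M₂ A (M₁ X)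

  ⟦_⟧ : Form → Set
  ⟦ atom a ⟧ = ⟦ a ⟧ᵃ
  ⟦ ¬' φ ⟧   = ¬ ⟦ φ ⟧
  ⟦ φ ∧' χ ⟧ = ⟦ φ ⟧ × ⟦ χ ⟧
  ⟦ φ ∨' χ ⟧ = ⟦ φ ⟧ ⊎ ⟦ χ ⟧
  ⟦ φ ⇒' χ ⟧ = ⟦ φ ⟧ → ⟦ χ ⟧
  ⟦ φ ⇔' χ ⟧ = (⟦ φ ⟧ → ⟦ χ ⟧) × (⟦ χ ⟧ → ⟦ φ ⟧)

_⊨_ : Interp → Form → Set
I ⊨ φ = ⟦_⟧ I φ

atoms : Form → List Atom
atoms (atom a) = a ∷ []
atoms (¬' φ)   = atoms φ
atoms (φ ∧' χ) = atoms φ ++ atoms χ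
atoms (φ ∨' χ) = atoms φ ++ atoms χ
atoms (φ ⇒' χ) = atoms φ ++ atoms χ
atoms (φ ⇔' χ) = atoms φ ++ atoms χ

vars₀ᵃ : Atom → List Var₀
vars₀ᵃ (eq₀ x y)      = x ∷ y ∷ []
vars₀ᵃ (mem₀ x X)     = x ∷ []
vars₀ᵃ (enumEq xs X)  = toList xs
vars₀ᵃ (enumMem xs A) = toList xs
vars₀ᵃ (eq₁ X Y)      = []
vars₀ᵃ (mem₁ X A)     = []

vars₁ᵃ : Atom → List Var₁
vars₁ᵃ (eq₀ x y)      = []
vars₁ᵃ (mem₀ x X)     = X ∷ []
vars₁ᵃ (enumEq xs X)  = X ∷ []
vars₁ᵃ (enumMem xs A) = []
vars₁ᵃ (eq₁ X Y)      = X ∷ Y ∷ []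
vars₁ᵃ (mem₁ X A)     = X ∷ []

vars₁ᵃ-strict : Atom → List Var₁
vars₁ᵃ-strict (eq₁ X Y)  = X ∷ Y ∷ []
vars₁ᵃ-strict (mem₁ X A) = X ∷ []
vars₁ᵃ-strict _          = []

enumLen : Atom → List ℕ
enumLen (enumEq xs X)  = length (toList xs) ∷ []
enumLen (enumMem xs A) = length (toList xs) ∷ []
enumLen _              = []

VarOcc₀ : Var₀ → Form → Set
VarOcc₀ x φ = Σ Atom λ a → (a ∈ atoms φ) × (x ∈ vars₀ᵃ a)

VarOcc₁ : Var₁ → Form → Set
VarOcc₁ X φ = Σ Atom λ a → (a ∈ atoms φ) × (X ∈ vars₁ᵃ a)

VarOcc₁-strict : Var₁ → Form → Set
VarOcc₁-strict X φ = Σ Atom λ a → (a ∈ atoms φ) × (X ∈ vars₁ᵃ-strict a)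

EnumLenOcc : ℕ → Form → Set
EnumLenOcc k φ = Σ Atom λ a → (a ∈ atoms φ) × (k ∈ enumLen a)

-- Relativized interpretation Rel(M, D*, d*, V0', V1', l)
-- D* ⊆ D is given by its characteristic function, and the domain of
-- the relativized interpretation is the subtype Σ D (T ∘ D*).

module Relativize (I : Interp) (Dstar : Interp.D I → Bool)
                  (dstar : Interp.D I) (dstar∈ : T (Dstar dstar))
                  (V₀' : Var₀ → Set) (V₁' : Var₁ → Set) (l : ℕ) where
  open Interp I

  D* : Set
  D* = Σ D λ d → T (Dstar d)

  lift : Subset D* → Subset D
  lift s d = Σ (T (Dstar d)) λ p → s (d , p)

  pick : (d : D) → Dec (T (Dstar d)) → D*
  pick d (yes p) = d , p
  pick d (no _)  = dstar , dstar∈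

  M*₀ : Var₀ → D*
  M*₀ x = pick (M₀ x) (T? (Dstar (M₀ x)))

  M*₁ : Var₁ → Subset D*
  M*₁ X e = M₁ X (proj₁ e)

  S : Subset D*
  S e = Σ Var₀ λ x → V₀' x × (M*₀ x ≡ e)

  PowS : Subset D* → Set
  PowS s = (s ⊆ S) × card≤ l s

  IsM*V₁' : Subset D* → Set
  IsM*V₁' s = Σ Var₁ λ X → V₁' X × (s ≐ M*₁ X)

  M*₂ : Var₂ → Subset (Subset D*)
  M*₂ A s =
      (M₂ A (lift s) × ¬ IsM*V₁' s × ¬ PowS s)
    ⊎ (Σ Var₁ λ X → V₁' X × (s ≐ M*₁ X) × M₂ A (M₁ X))
    ⊎ (PowS s × M₂ A (lift s))

  private
    lift-ext : ∀ {s t} → s ≐ t → lift s ≐ lift t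
    lift-ext (a , b) = (λ d u → proj₁ u , a (_ , proj₁ u) (proj₂ u))
                     , (λ d u → proj₁ u , b (_ , proj₁ u) (proj₂ u))

    card-ext : ∀ {s t : Subset D*} → s ≐ t → card≤ l s → card≤ l t
    card-ext (a , b) (xs , len , cov) = xs , len , λ e te → cov e (b e te)

    PowS-ext : ∀ {s t} → s ≐ t → PowS s → PowS t
    PowS-ext eq (sub , c) = (λ e te → sub e (proj₂ eq e te)) , card-ext eq c

    IsM-ext : ∀ {s t} → s ≐ t → IsM*V₁' s → IsM*V₁' t
    IsM-ext eq (X , v , e) = X , v , ≐-trans (≐-sym eq) e

    M*₂-ext : ∀ A {s t} → s ≐ t → M*₂ A s → M*₂ A t
    M*₂-ext A eq (inj₁ (m , ni , np)) =
      inj₁ (M₂-ext A (lift-ext eq) m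
           , (λ i → ni (IsM-ext (≐-sym eq) i))
           , (λ p → np (PowS-ext (≐-sym eq) p)))
    M*₂-ext A eq (inj₂ (inj₁ (X , v , e , m))) =
      inj₂ (inj₁ (X , v , ≐-trans (≐-sym eq) e , m))
    M*₂-ext A eq (inj₂ (inj₂ (p , m))) =
      inj₂ (inj₂ (PowS-ext eq p , M₂-ext A (lift-ext eq) m))

  M* : Interp
  M* = record { D = D* ; M₀ = M*₀ ; M₁ = M*₁ ; M₂ = M*₂ ; M₂-ext = M*₂-ext }

Rel : (I : Interp) (Dstar : Interp.D I → Bool)
      (dstar : Interp.D I) → T (Dstar dstar) →
      (Var₀ → Set) → (Var₁ → Set) → ℕ → Interp
Rel I Dstar dstar dstar∈ V₀' V₁' l = Relativize.M* I Dstar dstar dstar∈ V₀' V₁' l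

module Submission where

-- Since ψ is a propositional combination of atoms, it suffices that M and
-- M* agree on every atom occurring in ψ (lemma `agreement`, valid for any
-- two interpretations).

open import Defs
open import Level using (0ℓ)
open import Axiom.ExcludedMiddle using (ExcludedMiddle)
open import Data.Nat using (ℕ; _≤_; _>_)
open import Data.Bool using (Bool; T)
open import Data.Bool.Properties using (T?; T-irrelevant)
open import Data.Empty using (⊥-elim)
open import Data.Product using (Σ; _×_; _,_; proj₁; proj₂)
open import Data.Product.Function.NonDependent.Propositional using (_×-⇔_)
open import Data.Sum using (inj₁; inj₂)
open import Data.Sum.Function.Propositional using (_⊎-⇔_)
open import Data.List using (List; _++_; length; map)
open import Data.List.NonEmpty using (toList)
open import Data.List.Properties using (length-map)
open import Data.List.Relation.Unary.Any using (Any; here; there)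
open import Data.List.Relation.Unary.Any.Properties using (map⁺)
open import Data.List.Membership.Propositional using (_∈_; find; lose)
open import Data.List.Membership.Propositional.Properties using (∈-++⁺ˡ; ∈-++⁺ʳ)
open import Relation.Nullary using (¬_; yes; no; contradiction)
open import Relation.Binary.PropositionalEquality using (_≡_; refl; sym; cong; subst)
open import Function.Bundles using (_⇔_; mk⇔; Equivalence)
open import Function.Construct.Identity using (⇔-id)
open import Function.Construct.Symmetry using (⇔-sym)
open import Function.Related.TypeIsomorphisms using (¬-cong-⇔; →-cong-⇔)

open Equivalence using (to; from)

≐-refl : ∀ {E : Set} {s : Subset E} → s ≐ s
≐-refl = (λ _ m → m) , (λ _ m → m)

card≤-⊆ : ∀ {E : Set} {l : ℕ} {s t : Subset E} → card≤ l s → t ⊆ s → card≤ l t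
card≤-⊆ (es , len , cover) t⊆s = es , len , λ e te → cover e (t⊆s e te)

Any-map-∈ : ∀ {A : Set} {P Q : A → Set} {xs : List A} →
  (∀ {x} → x ∈ xs → P x → Q x) → Any P xs → Any Q xs
Any-map-∈ f a with find a
... | _ , x∈xs , px = lose x∈xs (f x∈xs px)

card≤-enum : ∀ (J : Interp) {l} xs → length (toList xs) ≤ l → card≤ l (enumSet J xs)
card≤-enum J {l} xs k≤l =
  map (Interp.M₀ J) (toList xs) ,
  subst (_≤ l) (sym (length-map (Interp.M₀ J) (toList xs))) k≤l ,
  λ _ d∈ → map⁺ d∈

Agree : Interp → Interp → Atom → Set
Agree I J a = ⟦_⟧ᵃ I a ⇔ ⟦_⟧ᵃ J a

on-left : ∀ {P : Atom → Set} φ χ →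
  (∀ {a} → a ∈ atoms φ ++ atoms χ → P a) → ∀ {a} → a ∈ atoms φ → P a
on-left φ χ all m = all (∈-++⁺ˡ m)

on-right : ∀ {P : Atom → Set} φ χ →
  (∀ {a} → a ∈ atoms φ ++ atoms χ → P a) → ∀ {a} → a ∈ atoms χ → P a
on-right φ χ all m = all (∈-++⁺ʳ (atoms φ) m)

-- Agreement on the atoms of φ yields agreement on φ, since every connective
-- is interpreted by a type former (¬, ×, ⊎, →) that respects ⇔.
agreement : (I J : Interp) (φ : Form) →
  (∀ {a} → a ∈ atoms φ → Agree I J a) → (I ⊨ φ) ⇔ (J ⊨ φ)
agreement I J (atom a) agree = agree (here refl)
agreement I J (¬' φ) agree = ¬-cong-⇔ (agreement I J φ agree)
agreement I J (φ ∧' χ) agree =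
  agreement I J φ (on-left φ χ agree) ×-⇔ agreement I J χ (on-right φ χ agree)
agreement I J (φ ∨' χ) agree =
  agreement I J φ (on-left φ χ agree) ⊎-⇔ agreement I J χ (on-right φ χ agree)
agreement I J (φ ⇒' χ) agree =
  →-cong-⇔ (agreement I J φ (on-left φ χ agree)) (agreement I J χ (on-right φ χ agree))
agreement I J (φ ⇔' χ) agree = →-cong-⇔ φ⇔ χ⇔ ×-⇔ →-cong-⇔ χ⇔ φ⇔
  where
    φ⇔ : (I ⊨ φ) ⇔ (J ⊨ φ)
    φ⇔ = agreement I J φ (on-left φ χ agree)
    χ⇔ : (I ⊨ χ) ⇔ (J ⊨ χ)
    χ⇔ = agreement I J χ (on-right φ χ agree)

module RelativizeFacts (I : Interp) (Dstar : Interp.D I → Bool)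
                       (dstar : Interp.D I) (dstar∈ : T (Dstar dstar))
                       (V₀' : Var₀ → Set) (V₁' : Var₁ → Set) (l : ℕ) where
  open Interp I
  open Relativize I Dstar dstar dstar∈ V₀' V₁' l

  point-≡ : ∀ {d e} {p : T (Dstar d)} {q : T (Dstar e)} →
    (_≡_ {A = D*} (d , p) (e , q)) ⇔ (d ≡ e)
  point-≡ {p = p} {q} = mk⇔ (cong proj₁) λ { refl → cong (_ ,_) (T-irrelevant p q) }

  M*₀-inside : ∀ x (px : T (Dstar (M₀ x))) → M*₀ x ≡ (M₀ x , px)
  M*₀-inside x px with T? (Dstar (M₀ x))
  ... | yes q = cong (M₀ x ,_) (T-irrelevant q px)
  ... | no ¬q = contradiction px ¬q

  ≡M*₀ : ∀ {d} (p : T (Dstar d)) x → T (Dstar (M₀ x)) → ((d , p) ≡ M*₀ x) ⇔ (d ≡ M₀ x)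
  ≡M*₀ p x px rewrite M*₀-inside x px = point-≡

  lift-ext : ∀ {s t} → s ≐ t → lift s ≐ lift t
  lift-ext (s⊆t , t⊆s) = (λ d (p , m) → p , s⊆t (d , p) m)
                       , (λ d (p , m) → p , t⊆s (d , p) m)

  lift-injective : ∀ {s t} → lift s ≐ lift t → s ≐ t
  lift-injective {s} {t} (s⊆t , t⊆s) = reflect s⊆t , reflect t⊆s
    where
      reflect : ∀ {u v} → lift u ⊆ lift v → u ⊆ v
      reflect {v = v} u⊆v (d , p) m with u⊆v d (p , m)
      ... | q , m' = subst (λ r → v (d , r)) (T-irrelevant q p) m'

  lift-M*₁ : ∀ {X} → (∀ d → M₁ X d → T (Dstar d)) → lift (M*₁ X) ≐ M₁ X
  lift-M*₁ inside = (λ _ m → proj₂ m) , (λ d m → inside d m , m)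

  M*₁-≐ : ∀ {X Y} → M₁ X ≐ M₁ Y → M*₁ X ≐ M*₁ Y
  M*₁-≐ (X⊆Y , Y⊆X) = (λ e → X⊆Y (proj₁ e)) , (λ e → Y⊆X (proj₁ e))

  Faithful : Var₁ → Set
  Faithful X = lift (M*₁ X) ≐ M₁ X

  InsideAll : List Var₀ → Set
  InsideAll xs = ∀ {x} → x ∈ xs → T (Dstar (M₀ x))

  enum-inside : ∀ {xs} → InsideAll (toList xs) → enumSet I xs ⊆ (λ d → T (Dstar d))
  enum-inside inside d d∈ with find d∈
  ... | _ , x∈ , refl = inside x∈

  lift-enum : ∀ {xs} → InsideAll (toList xs) → lift (enumSet M* xs) ≐ enumSet I xs
  lift-enum {xs} inside =
      (λ d (p , d∈) → Any-map-∈ (λ x∈ → to (≡M*₀ p _ (inside x∈))) d∈)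
    , (λ d d∈ → let p = enum-inside {xs} inside d d∈ in
                p , Any-map-∈ (λ x∈ → from (≡M*₀ p _ (inside x∈))) d∈)

  enumEq-preserve : ∀ {xs X} → InsideAll (toList xs) →
    enumSet I xs ≐ M₁ X → enumSet M* xs ≐ M*₁ X
  enumEq-preserve {xs} {X} inside e =
    lift-injective (≐-trans (lift-enum inside) (≐-trans e (≐-sym (lift-M*₁ X⊆D*))))
    where
      X⊆D* : ∀ d → M₁ X d → T (Dstar d)
      X⊆D* d m = enum-inside {xs} inside d (proj₂ e d m)

  enumEq-reflect : ∀ {xs X} → InsideAll (toList xs) → Faithful X →
    enumSet M* xs ≐ M*₁ X → enumSet I xs ≐ M₁ X
  enumEq-reflect inside faithful e =
    ≐-trans (≐-sym (lift-enum inside)) (≐-trans (lift-ext e) faithful)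

  eq₀-agree : ∀ {x y} → T (Dstar (M₀ x)) → T (Dstar (M₀ y)) → Agree I M* (eq₀ x y)
  eq₀-agree {x} {y} px py rewrite M*₀-inside x px | M*₀-inside y py = ⇔-sym point-≡

  mem₀-agree : ∀ {x X} → T (Dstar (M₀ x)) → Agree I M* (mem₀ x X)
  mem₀-agree {x} {X} px rewrite M*₀-inside x px = ⇔-id (M₁ X (M₀ x))

  -- Consequences of the hypotheses of the corollary on V1' (with excluded
  -- middle, needed to decide membership in V1', smallness and equality).

  module Separated
    (lem : ExcludedMiddle 0ℓ)
    (kept : ∀ X → V₁' X →
      (card≤ l (M₁ X) → Faithful X) × (¬ card≤ l (M₁ X) → card> l (M*₁ X)))
    (separated : ∀ X Y → V₁' X → V₁' Y → ¬ (M₁ X ≐ M₁ Y) →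
      Σ D λ d → T (Dstar d) × SymDiff (M₁ X) (M₁ Y) d)
    where

    small-faithful : ∀ {X} → V₁' X → card≤ l (M*₁ X) → Faithful X
    small-faithful {X} v small* with lem {card≤ l (M₁ X)}
    ... | yes small = proj₁ (kept X v) small
    ... | no large = contradiction small* (proj₂ (kept X v) large)

    V₁'-reflect : ∀ {X Y} → V₁' X → V₁' Y → M*₁ X ≐ M*₁ Y → M₁ X ≐ M₁ Y
    V₁'-reflect {X} {Y} vX vY (X⊆Y , Y⊆X) with lem {M₁ X ≐ M₁ Y}
    ... | yes e = e
    ... | no ne with separated X Y vX vY ne
    ...   | d , p , inj₁ (inX , ∉Y) = ⊥-elim (∉Y (X⊆Y (d , p) inX))
    ...   | d , p , inj₂ (inY , ∉X) = ⊥-elim (∉X (Y⊆X (d , p) inY))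

    enumEq-reflect-V₁' : ∀ {xs X} → InsideAll (toList xs) → length (toList xs) ≤ l →
      V₁' X → enumSet M* xs ≐ M*₁ X → enumSet I xs ≐ M₁ X
    enumEq-reflect-V₁' {xs} inside k≤l v e =
      enumEq-reflect inside (small-faithful v (card≤-⊆ (card≤-enum M* xs k≤l) (proj₂ e))) e

    -- Agreement on each kind of atom, under the side conditions of ψ.
    -- {x1,...,xk} = X: reflected through the faithfulness of X, which holds
    -- for X ∈ V1' because M*X equals an enumeration of at most l points.
    enumEq-agree : ∀ {xs X} → InsideAll (toList xs) → length (toList xs) ≤ l →
      (¬ V₁' X → Faithful X) → Agree I M* (enumEq xs X)
    enumEq-agree {xs} {X} inside k≤l unchanged = mk⇔ (enumEq-preserve inside) reflect
      where
        reflect : enumSet M* xs ≐ M*₁ X → enumSet I xs ≐ M₁ X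
        reflect e with lem {V₁' X}
        ... | yes v = enumEq-reflect-V₁' inside k≤l v e
        ... | no nv = enumEq-reflect inside (unchanged nv) e

    -- X = Y: preserved by relativization, reflected by separation.
    eq₁-agree : ∀ {X Y} → V₁' X → V₁' Y → Agree I M* (eq₁ X Y)
    eq₁-agree vX vY = mk⇔ M*₁-≐ (V₁'-reflect vX vY)

    -- X ∈ A: the second clause of M*A holds exactly when MX ∈ MA; the first
    -- clause never applies to M*X, and the third only when M*X is small.
    mem₁-agree : ∀ {X A} → V₁' X → Agree I M* (mem₁ X A)
    mem₁-agree {X} {A} v = mk⇔ (λ m → inj₂ (inj₁ (X , v , ≐-refl , m))) reflect
      where
        reflect : M*₂ A (M*₁ X) → M₂ A (M₁ X)
        reflect (inj₁ (_ , not-V₁' , _)) = ⊥-elim (not-V₁' (X , v , ≐-refl))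
        reflect (inj₂ (inj₁ (Y , vY , e , m))) = M₂-ext A (≐-sym (V₁'-reflect v vY e)) m
        reflect (inj₂ (inj₂ ((_ , small) , m))) = M₂-ext A (small-faithful v small) m

    -- {x1,...,xk} ∈ A: whichever clause of M*A applies, it tests MA on a set
    -- equal to {x1,...,xk} in M.
    enumMem-agree : ∀ {xs A} → InsideAll (toList xs) → length (toList xs) ≤ l →
      Agree I M* (enumMem xs A)
    enumMem-agree {xs} {A} inside k≤l = mk⇔ preserve reflect
      where
        E* : Subset D*
        E* = enumSet M* xs

        lift-E* : lift E* ≐ enumSet I xs
        lift-E* = lift-enum {xs} inside

        preserve : M₂ A (enumSet I xs) → M*₂ A E*
        preserve m with lem {PowS E*} | lem {IsM*V₁' E*}
        ... | yes pow | _ = inj₂ (inj₂ (pow , M₂-ext A (≐-sym lift-E*) m))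
        ... | no _ | yes (X , v , e) =
          inj₂ (inj₁ (X , v , e , M₂-ext A (enumEq-reflect-V₁' inside k≤l v e) m))
        ... | no not-pow | no not-V₁' = inj₁ (M₂-ext A (≐-sym lift-E*) m , not-V₁' , not-pow)

        reflect : M*₂ A E* → M₂ A (enumSet I xs)
        reflect (inj₁ (m , _ , _)) = M₂-ext A lift-E* m
        reflect (inj₂ (inj₁ (X , v , e , m))) =
          M₂-ext A (≐-sym (enumEq-reflect-V₁' inside k≤l v e)) m
        reflect (inj₂ (inj₂ (_ , m))) = M₂-ext A lift-E* m

-- Corollary 3.3: each atom of ψ meets the hypotheses of one of the
-- atom-agreement lemmas above.

corollary3p3 : ExcludedMiddle 0ℓ →
    (I : Interp) (Dstar : Interp.D I → Bool)
    (dstar : Interp.D I) (dstar∈ : T (Dstar dstar))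
    (V₀' : Var₀ → Set) (V₁' : Var₁ → Set) (l : ℕ) → l > 0 →
    (ψ : Form) →
    (∀ x → VarOcc₀ x ψ → T (Dstar (Interp.M₀ I x))) →
    (∀ k → EnumLenOcc k ψ → k ≤ l) →
    (∀ X → VarOcc₁-strict X ψ → V₁' X) →
    (∀ X → V₁' X →
      (card≤ l (Interp.M₁ I X) →
        Relativize.lift I Dstar dstar dstar∈ V₀' V₁' l
          (Interp.M₁ (Rel I Dstar dstar dstar∈ V₀' V₁' l) X) ≐ Interp.M₁ I X)
      × (¬ card≤ l (Interp.M₁ I X) →
        card> l (Interp.M₁ (Rel I Dstar dstar dstar∈ V₀' V₁' l) X))) →
    (∀ X Y → V₁' X → V₁' Y → ¬ (Interp.M₁ I X ≐ Interp.M₁ I Y) →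
      Σ (Interp.D I) λ d → T (Dstar d) × SymDiff (Interp.M₁ I X) (Interp.M₁ I Y) d) →
    (∀ X → ¬ V₁' X → VarOcc₁ X ψ →
      Relativize.lift I Dstar dstar dstar∈ V₀' V₁' l
        (Interp.M₁ (Rel I Dstar dstar dstar∈ V₀' V₁' l) X) ≐ Interp.M₁ I X) →
    (I ⊨ ψ) ⇔ (Rel I Dstar dstar dstar∈ V₀' V₁' l ⊨ ψ)
corollary3p3 lem I Dstar dstar dstar∈ V₀' V₁' l _ ψ inside short strict kept separated unchanged =
  agreement I M* ψ atom-agree
  where
    open Relativize I Dstar dstar dstar∈ V₀' V₁' l using (M*)
    open RelativizeFacts I Dstar dstar dstar∈ V₀' V₁' l
    open Separated lem kept separated

    atom-agree : ∀ {a} → a ∈ atoms ψ → Agree I M* a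
    atom-agree {eq₀ x y} a∈ = eq₀-agree (inside x (_ , a∈ , here refl))
                                        (inside y (_ , a∈ , there (here refl)))
    atom-agree {mem₀ x X} a∈ = mem₀-agree (inside x (_ , a∈ , here refl))
    atom-agree {enumEq xs X} a∈ = enumEq-agree (λ x∈ → inside _ (_ , a∈ , x∈))
      (short _ (_ , a∈ , here refl)) (λ nv → unchanged X nv (_ , a∈ , here refl))
    atom-agree {enumMem xs A} a∈ = enumMem-agree (λ x∈ → inside _ (_ , a∈ , x∈))
      (short _ (_ , a∈ , here refl))
    atom-agree {eq₁ X Y} a∈ = eq₁-agree (strict X (_ , a∈ , here refl))
                                        (strict Y (_ , a∈ , there (here refl)))
    atom-agree {mem₁ X A} a∈ = mem₁-agree (strict X (_ , a∈ , here refl))
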